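{- Let $a, b$ be positive integers with $4 \leq a \leq b$. Then $\mathcal{G}_{\mathcal{R}}(a,b) \geq b-2a+1$.
   Context: A position is an unordered pair $(a,b)$ of nonnegative integers (pile sizes). $\mathcal{R}$-Wythoff: a move either removes a positive number of tokens from the larger pile (or from either pile if both piles have equal size), or removes the same positive number of tokens from both piles. $\mathcal{G}_{\mathcal{R}}$ is the Sprague-Grundy function of $\mathcal{R}$-Wythoff: $\mathcal{G}_{\mathcal{R}}(p)=\mathrm{mex}\{\mathcal{G}_{\mathcal{R}}(q): q \text{ reachable from } p \text{ in one move}\}$, where $\mathrm{mex}(S)$ is the least nonnegative integer not in $S$ and $\mathrm{mex}\{\}=0$. -}

module Defs where

open import Data.Nat using (ℕ; zero; suc; _+_; _∸_; _⊓_; _⊔_; _≡ᵇ_; _<ᵇ_)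
open import Data.Bool using (Bool; true; false; if_then_else_; _∨_)
open import Data.List using (List; []; _∷_; map; _++_; length)
open import Data.Bool.ListAction using (any)
open import Data.Product using (_×_; _,_)

elemᵇ : ℕ → List ℕ → Bool
elemᵇ n xs = any (λ m → n ≡ᵇ m) xs

-- mex: least natural number not occurring in the list.
-- Searching from k upward with fuel (length + 1) suffices, since a list of
-- length L misses some element of {0,…,L}.
mexFrom : ℕ → ℕ → List ℕ → ℕ
mexFrom zero    k xs = k
mexFrom (suc f) k xs = if elemᵇ k xs then mexFrom f (suc k) xs else k

mex : List ℕ → ℕ
mex xs = mexFrom (suc (length xs)) 0 xs

oneTo : ℕ → List ℕ
oneTo zero    = []
oneTo (suc n) = oneTo n ++ (suc n ∷ [])

-- Options of the R-Wythoff position {x, y}, normalised to (s, l) with s ≤ l.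
--  * remove k (1 ≤ k ≤ l) from the larger pile: (s, l ∸ k)
--    (when s = l this also covers removing from "either" pile, by symmetry
--     of unordered positions)
--  * remove k (1 ≤ k ≤ s) from both piles: (s ∸ k, l ∸ k)
optionsR : ℕ → ℕ → List (ℕ × ℕ)
optionsR x y =
  let s = x ⊓ y ; l = x ⊔ y in
  map (λ k → (s , l ∸ k)) (oneTo l) ++ map (λ k → (s ∸ k , l ∸ k)) (oneTo s)

-- Grundy value with fuel; every move strictly decreases the total a + b,
-- so fuel a + b is sufficient (fuel 0 only occurs at (0,0), a terminal P-position).
grundyFuel : ℕ → ℕ → ℕ → ℕ
grundyFuel zero    a b = 0
grundyFuel (suc f) a b = mex (map (λ p → grundyFuel f (Data.Product.proj₁ p) (Data.Product.proj₂ p)) (optionsR a b))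

GR : ℕ → ℕ → ℕ
GR a b = grundyFuel (a + b) a b

-- Write v = G(a,b).  For every c with a ≤ c < b the position (a,c) is an
-- option of (a,b), so G(a,c) ≠ v; hence either G(a,c) < v, or v is the value
-- of some option of (a,c).  In the second case that option cannot lie in
-- row a (those are options of (a,b) too), so it is a diagonal option
-- (a−k, c−k) with 1 ≤ k ≤ a.  Encoding c by G(a,c) in the first case and by
-- v + (a−k) in the second gives an injection of {a,…,b−1} into {0,…,v+a−1}
-- which, for a ≥ 3, misses one value (a if v > a; otherwise v + j for a
-- row j < a that never contains the value v).  Hence b − a < v + a, which is
-- the claim; the argument in fact needs only a ≥ 3.
module Submission where

open import Defs
open import Data.Nat using (ℕ; _+_; _∸_; _≤_; _*_)
open import Data.Nat using (zero; suc; _<_; _⊓_; _⊔_; _≡ᵇ_; z≤n; s≤s)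
open import Data.Nat.Properties
open import Data.Nat.Induction using (<-rec)
open import Data.Nat.Solver using (module +-*-Solver)
open import Data.Bool using (true; false)
open import Data.Bool.Properties using (T-≡)
open import Function.Bundles using (Equivalence)
open import Data.List using (List; map; _++_; length; lookup)
open import Data.List.Properties using (map-cong-local)
open import Data.List.Membership.Propositional using (_∈_)
open import Data.List.Membership.Propositional.Properties using (∈-map⁺; ∈-map⁻; ∈-++⁺ˡ; ∈-++⁺ʳ; ∈-++⁻)
open import Data.List.Relation.Unary.All as All using ()
open import Data.List.Relation.Unary.Any as Any using (here; index)
open import Data.List.Relation.Unary.Any.Properties using (any⁺; any⁻; lookup-index)
open import Data.Product using (_×_; _,_; proj₁; proj₂; Σ)
open import Data.Sum using (_⊎_; inj₁; inj₂)
open import Data.Empty using (⊥-elim)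
open import Data.Fin using (Fin; toℕ; fromℕ<; punchOut)
open import Data.Fin.Properties using (injective⇒≤; toℕ-fromℕ<; toℕ-injective; toℕ<n; punchOut-injective)
open import Function.Definitions using (Injective)
open import Relation.Nullary using (¬_)
open import Relation.Binary.PropositionalEquality
open import Relation.Binary.Definitions using (tri<; tri≈; tri>)

elemᵇ-sound : ∀ n xs → elemᵇ n xs ≡ true → n ∈ xs
elemᵇ-sound n xs found = Any.map (λ {m} → ≡ᵇ⇒≡ n m) (any⁻ _ xs (Equivalence.from T-≡ found))

elemᵇ-complete : ∀ n xs → n ∈ xs → elemᵇ n xs ≡ true
elemᵇ-complete n xs n∈ = Equivalence.to T-≡ (any⁺ (n ≡ᵇ_) (Any.map (λ {m} → ≡⇒≡ᵇ n m) n∈))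

mexFrom-below : ∀ f k xs u → k ≤ u → u < mexFrom f k xs → u ∈ xs
mexFrom-below zero    k xs u k≤u u<k = ⊥-elim (<-irrefl refl (≤-<-trans k≤u u<k))
mexFrom-below (suc f) k xs u k≤u u<mex with elemᵇ k xs in k∈?
... | false = ⊥-elim (<-irrefl refl (≤-<-trans k≤u u<mex))
... | true with m≤n⇒m<n∨m≡n k≤u
...   | inj₁ k<u  = mexFrom-below f (suc k) xs u k<u u<mex
...   | inj₂ refl = elemᵇ-sound k xs k∈?

mexFrom-out-of-fuel : ∀ f k xs → mexFrom f k xs ∈ xs → mexFrom f k xs ≡ k + f
mexFrom-out-of-fuel zero    k xs _ = sym (+-identityʳ k)
mexFrom-out-of-fuel (suc f) k xs p with elemᵇ k xs in k∈?
... | false with () ← trans (sym (elemᵇ-complete k xs p)) k∈?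
... | true  = trans (mexFrom-out-of-fuel f (suc k) xs p) (sym (+-suc k f))

mex-below : ∀ xs u → u < mex xs → u ∈ xs
mex-below xs u = mexFrom-below (suc (length xs)) 0 xs u z≤n

initial-segment-length : ∀ n xs → (∀ u → u < n → u ∈ xs) → n ≤ length xs
initial-segment-length n xs all∈ = injective⇒≤ {f = position} position-injective
  where
  position : Fin n → Fin (length xs)
  position i = index (all∈ (toℕ i) (toℕ<n i))

  position-injective : Injective _≡_ _≡_ position
  position-injective {i} {j} eq = toℕ-injective (begin
    toℕ i                  ≡⟨ lookup-index (all∈ (toℕ i) (toℕ<n i)) ⟩
    lookup xs (position i) ≡⟨ cong (lookup xs) eq ⟩
    lookup xs (position j) ≡⟨ lookup-index (all∈ (toℕ j) (toℕ<n j)) ⟨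
    toℕ j                  ∎)
    where open ≡-Reasoning

-- … and is itself missing from xs: otherwise the search ran out of fuel,
-- so xs would contain the length(xs)+1 values 0,…,length(xs).
mex-notin : ∀ xs → ¬ (mex xs ∈ xs)
mex-notin xs mex∈ = <-irrefl refl (initial-segment-length (suc (length xs)) xs all∈)
  where
  mex≡ : mex xs ≡ suc (length xs)
  mex≡ = mexFrom-out-of-fuel (suc (length xs)) 0 xs mex∈

  all∈ : ∀ u → u < suc (length xs) → u ∈ xs
  all∈ u u< = mex-below xs u (subst (u <_) (sym mex≡) u<)

moves : ℕ → ℕ → List (ℕ × ℕ)
moves s l = map (λ k → (s , l ∸ k)) (oneTo l) ++ map (λ k → (s ∸ k , l ∸ k)) (oneTo s)

oneTo-complete : ∀ {k} n → 1 ≤ k → k ≤ n → k ∈ oneTo n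
oneTo-complete zero    (s≤s _) ()
oneTo-complete {k} (suc n) 1≤k k≤1+n with m≤n⇒m<n∨m≡n k≤1+n
... | inj₁ (s≤s k≤n) = ∈-++⁺ˡ (oneTo-complete n 1≤k k≤n)
... | inj₂ refl      = ∈-++⁺ʳ (oneTo n) (here refl)

oneTo-sound : ∀ {k} n → k ∈ oneTo n → 1 ≤ k × k ≤ n
oneTo-sound (suc n) k∈ with ∈-++⁻ (oneTo n) k∈
... | inj₁ k∈′ = let (1≤k , k≤n) = oneTo-sound n k∈′ in 1≤k , m≤n⇒m≤1+n k≤n
... | inj₂ (here refl) = s≤s z≤n , ≤-refl

moves-inv : ∀ s l p → p ∈ moves s l →
  (Σ ℕ λ k → 1 ≤ k × k ≤ l × p ≡ (s , l ∸ k)) ⊎ (Σ ℕ λ k → 1 ≤ k × k ≤ s × p ≡ (s ∸ k , l ∸ k))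
moves-inv s l p p∈ with ∈-++⁻ (map (λ k → (s , l ∸ k)) (oneTo l)) p∈
... | inj₁ p∈row with ∈-map⁻ (λ k → (s , l ∸ k)) p∈row
...   | k , k∈ , refl = inj₁ (k , proj₁ (oneTo-sound l k∈) , proj₂ (oneTo-sound l k∈) , refl)
moves-inv s l p p∈ | inj₂ p∈diag with ∈-map⁻ (λ k → (s ∸ k , l ∸ k)) p∈diag
...   | k , k∈ , refl = inj₂ (k , proj₁ (oneTo-sound s k∈) , proj₂ (oneTo-sound s k∈) , refl)

moves-decrease : ∀ s l p → p ∈ moves s l → proj₁ p + proj₂ p < s + l
moves-decrease s l p p∈ with moves-inv s l p p∈
... | inj₁ (k , 1≤k , k≤l , refl) = +-monoʳ-< s (∸-monoʳ-< 1≤k k≤l)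
... | inj₂ (k , 1≤k , k≤s , refl) = +-mono-<-≤ (∸-monoʳ-< 1≤k k≤s) (m∸n≤m l k)

⊓+⊔ : ∀ x y → (x ⊓ y) + (x ⊔ y) ≡ x + y
⊓+⊔ x y with ≤-total x y
... | inj₁ x≤y = cong₂ _+_ (m≤n⇒m⊓n≡m x≤y) (m≤n⇒m⊔n≡n x≤y)
... | inj₂ y≤x = trans (cong₂ _+_ (m≥n⇒m⊓n≡n y≤x) (m≥n⇒m⊔n≡m y≤x)) (+-comm y x)

optionsR-decrease : ∀ x y p → p ∈ optionsR x y → proj₁ p + proj₂ p < x + y
optionsR-decrease x y p p∈ = subst (proj₁ p + proj₂ p <_) (⊓+⊔ x y) (moves-decrease (x ⊓ y) (x ⊔ y) p p∈)

grundyFuel-terminal : ∀ f → grundyFuel f 0 0 ≡ 0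
grundyFuel-terminal zero    = refl
grundyFuel-terminal (suc f) = refl

grundyFuel-irrelevant : ∀ f g x y → x + y ≤ f → x + y ≤ g → grundyFuel f x y ≡ grundyFuel g x y
grundyFuel-irrelevant zero    g       zero    zero    _  _  = sym (grundyFuel-terminal g)
grundyFuel-irrelevant (suc f) zero    zero    zero    _  _  = grundyFuel-terminal (suc f)
grundyFuel-irrelevant (suc f) (suc g) x       y       x+y≤f x+y≤g =
  cong mex (map-cong-local (All.tabulate λ {p} p∈ →
    let p< = optionsR-decrease x y p p∈ in
    grundyFuel-irrelevant f g (proj₁ p) (proj₂ p) (≤-pred (≤-trans p< x+y≤f)) (≤-pred (≤-trans p< x+y≤g))))
grundyFuel-irrelevant zero    _       zero    (suc _) () _
grundyFuel-irrelevant zero    _       (suc _) _       () _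
grundyFuel-irrelevant (suc _) zero    zero    (suc _) _ ()
grundyFuel-irrelevant (suc _) zero    (suc _) _       _ ()

Gp : ℕ × ℕ → ℕ
Gp p = GR (proj₁ p) (proj₂ p)

optionValues : ℕ → ℕ → List ℕ
optionValues s l = map Gp (moves s l)

grundyFuel-unfold : ∀ f x y → x + y ≤ suc f →
  grundyFuel (suc f) x y ≡ mex (optionValues (x ⊓ y) (x ⊔ y))
grundyFuel-unfold f x y x+y≤ = cong mex (map-cong-local (All.tabulate λ {p} p∈ →
  let p≤f = ≤-pred (≤-trans (optionsR-decrease x y p p∈) x+y≤) in
  grundyFuel-irrelevant f _ (proj₁ p) (proj₂ p) p≤f ≤-refl))

GR-recursion : ∀ x y → GR x y ≡ mex (optionValues (x ⊓ y) (x ⊔ y))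
GR-recursion zero    zero    = refl
GR-recursion zero    (suc y) = grundyFuel-unfold y zero (suc y) ≤-refl
GR-recursion (suc x) y       = grundyFuel-unfold (x + y) (suc x) y ≤-refl

GR-sym : ∀ x y → GR x y ≡ GR y x
GR-sym x y = begin
  GR x y                                   ≡⟨ GR-recursion x y ⟩
  mex (optionValues (x ⊓ y) (x ⊔ y))       ≡⟨ cong₂ (λ s l → mex (optionValues s l)) (⊓-comm x y) (⊔-comm x y) ⟩
  mex (optionValues (y ⊓ x) (y ⊔ x))       ≡⟨ GR-recursion y x ⟨
  GR y x                                   ∎
  where open ≡-Reasoning

GR-normal : ∀ {s l} → s ≤ l → GR s l ≡ mex (optionValues s l)
GR-normal {s} {l} s≤l =
  trans (GR-recursion s l) (cong₂ (λ s l → mex (optionValues s l)) (m≤n⇒m⊓n≡m s≤l) (m≤n⇒m⊔n≡n s≤l))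

row-option : ∀ s l c → c < l → GR s c ∈ optionValues s l
row-option s l c c<l = subst (λ z → GR s z ∈ optionValues s l) (m∸[m∸n]≡n (<⇒≤ c<l))
  (∈-map⁺ Gp (∈-++⁺ˡ (∈-map⁺ (λ k → (s , l ∸ k)) (oneTo-complete l (m<n⇒0<n∸m c<l) (m∸n≤m l c)))))

diagonal-option : ∀ s l k → 1 ≤ k → k ≤ s → GR (s ∸ k) (l ∸ k) ∈ optionValues s l
diagonal-option s l k 1≤k k≤s = ∈-map⁺ Gp (∈-++⁺ʳ (map (λ k → (s , l ∸ k)) (oneTo l))
  (∈-map⁺ (λ k → (s ∸ k , l ∸ k)) (oneTo-complete s 1≤k k≤s)))

option-inv : ∀ s l u → u ∈ optionValues s l →
  (Σ ℕ λ c → c < l × u ≡ GR s c) ⊎ (Σ ℕ λ k → 1 ≤ k × k ≤ s × u ≡ GR (s ∸ k) (l ∸ k))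
option-inv s l u u∈ with ∈-map⁻ Gp u∈
... | p , p∈ , refl with moves-inv s l p p∈
...   | inj₁ (k , 1≤k , k≤l , refl) = inj₁ (l ∸ k , ∸-monoʳ-< 1≤k k≤l , refl)
...   | inj₂ (k , 1≤k , k≤s , refl) = inj₂ (k , 1≤k , k≤s , refl)

GR-avoids : ∀ {s l u} → s ≤ l → u ∈ optionValues s l → GR s l ≢ u
GR-avoids {s} {l} s≤l u∈ G≡u =
  mex-notin (optionValues s l) (subst (_∈ optionValues s l) (trans (sym G≡u) (GR-normal s≤l)) u∈)

GR-covers : ∀ {s l u} → s ≤ l → u < GR s l → u ∈ optionValues s l
GR-covers {s} {l} {u} s≤l u<G = mex-below (optionValues s l) u (subst (u <_) (GR-normal s≤l) u<G)

-- On the edge of the board G is the pile size (the game is plain Nim there).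
GR-edge : ∀ d → GR 0 d ≡ d
GR-edge = <-rec (λ d → GR 0 d ≡ d) step
  where
  step : ∀ d → (∀ {c} → c < d → GR 0 c ≡ c) → GR 0 d ≡ d
  step d ih with <-cmp (GR 0 d) d
  ... | tri≈ _ G≡d _ = G≡d
  ... | tri< G<d _ _ = ⊥-elim (GR-avoids z≤n (row-option 0 d (GR 0 d) G<d) (sym (ih G<d)))
  ... | tri> _ _ d<G with option-inv 0 d d (GR-covers z≤n d<G)
  ...   | inj₁ (c , c<d , d≡Gc)     = ⊥-elim (<-irrefl (sym (trans d≡Gc (ih c<d))) c<d)
  ...   | inj₂ (_ , 1≤k , k≤0 , _) = ⊥-elim (<-irrefl refl (≤-trans 1≤k k≤0))

GR-edge′ : ∀ d → GR d 0 ≡ d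
GR-edge′ d = trans (GR-sym d 0) (GR-edge d)

-- Of two positions in the same row s the nearer one is an option of the
-- farther one, so G is injective along each row right of the diagonal.
GR-row-cancel : ∀ {s c c′} → s ≤ c → s ≤ c′ → GR s c ≡ GR s c′ → c ≡ c′
GR-row-cancel {s} {c} {c′} s≤c s≤c′ eq with <-cmp c c′
... | tri< c<c′ _ _ = ⊥-elim (GR-avoids s≤c′ (row-option s c′ c c<c′) (sym eq))
... | tri≈ _ c≡c′ _ = c≡c′
... | tri> _ _ c′<c = ⊥-elim (GR-avoids s≤c (row-option s c c′ c′<c) eq)

-- (s,0), of value s, is an option of (s,d) for d ≥ 1, so G(s,d) ≠ s.
GR-not-pile-size : ∀ {s d} → 1 ≤ d → s ≤ d → GR s d ≢ s
GR-not-pile-size {s} {d} 1≤d s≤d G≡s =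
  GR-avoids s≤d (row-option s d 0 1≤d) (trans G≡s (sym (GR-edge′ s)))

-- No position (2,d), d ≥ 2, is a P-position: it has an option of value 0,
-- namely (0,0), (1,2) or (2,1).
GR-two-nonzero : ∀ d → 2 ≤ d → GR 2 d ≢ 0
GR-two-nonzero 1                         (s≤s ())
GR-two-nonzero 2                         2≤d = GR-avoids 2≤d (diagonal-option 2 2 2 (s≤s z≤n) ≤-refl)
GR-two-nonzero 3                         2≤d = GR-avoids 2≤d (diagonal-option 2 3 1 (s≤s z≤n) (s≤s z≤n))
GR-two-nonzero (suc (suc (suc (suc d)))) 2≤d = GR-avoids 2≤d (row-option 2 (4 + d) 1 (s≤s (s≤s z≤n)))

injection-with-hole : ∀ {n N} (f : Fin n → ℕ) → Injective _≡_ _≡_ f →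
  (∀ i → f i < N) → ∀ {e} → e < N → (∀ i → f i ≢ e) → n < N
injection-with-hole {n} {suc M} f f-inj f<N {e} e<N f≢e = s≤s (injective⇒≤ {f = squeeze} squeeze-inj)
  where
  asFin : ∀ i → Fin (suc M)
  asFin i = fromℕ< (f<N i)

  hole≢ : ∀ i → fromℕ< e<N ≢ asFin i
  hole≢ i eq = f≢e i (begin
    f i                  ≡⟨ toℕ-fromℕ< (f<N i) ⟨
    toℕ (asFin i)        ≡⟨ cong toℕ eq ⟨
    toℕ (fromℕ< e<N)     ≡⟨ toℕ-fromℕ< e<N ⟩
    e                    ∎)
    where open ≡-Reasoning

  squeeze : Fin n → Fin M
  squeeze i = punchOut (hole≢ i)

  squeeze-inj : Injective _≡_ _≡_ squeeze
  squeeze-inj {i} {j} eq = f-inj (begin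
    f i               ≡⟨ toℕ-fromℕ< (f<N i) ⟨
    toℕ (asFin i)     ≡⟨ cong toℕ (punchOut-injective (hole≢ i) (hole≢ j) eq) ⟩
    toℕ (asFin j)     ≡⟨ toℕ-fromℕ< (f<N j) ⟩
    f j               ∎)
    where open ≡-Reasoning

row-avoiding : ∀ {a} v → 3 ≤ a → v < a → Σ ℕ λ j → j < a × (∀ {d} → j ≤ d → GR j d ≢ v)
row-avoiding zero          3≤a _   = 2 , 3≤a , λ {d} → GR-two-nonzero d
row-avoiding v@(suc _)     _   v<a = v , v<a , λ v≤d → GR-not-pile-size (≤-trans (s≤s z≤n) v≤d) v≤d

rearrange-bound : ∀ a b v → a ≤ b → b ∸ a < v + a → (b + 1) ∸ (2 * a) ≤ v
rearrange-bound a b v a≤b b∸a<v+a = m≤n+o⇒m∸n≤o (b + 1) (2 * a) (begin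
  b + 1              ≡⟨ +-comm b 1 ⟩
  suc b              ≡⟨ cong suc (m∸n+n≡m a≤b) ⟨
  suc (b ∸ a) + a    ≤⟨ +-monoˡ-≤ a b∸a<v+a ⟩
  v + a + a          ≡⟨ solve 2 (λ v a → v :+ a :+ a := con 2 :* a :+ v) refl v a ⟩
  2 * a + v          ∎)
  where
  open ≤-Reasoning
  open +-*-Solver

module RowCount (a b : ℕ) (a≤b : a ≤ b) where

  v : ℕ
  v = GR a b

  -- Why G(a,c) ≠ v for a ≤ c < b: either G(a,c) < v, or v is the value of
  -- a diagonal option (a−k, c−k) of (a,c).
  Reason : ℕ → Set
  Reason c = GR a c < v ⊎ (Σ ℕ λ k → 1 ≤ k × k ≤ a × GR (a ∸ k) (c ∸ k) ≡ v)

  reason : ∀ {c} → a ≤ c → c < b → Reason c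
  reason {c} a≤c c<b with <-cmp (GR a c) v
  ... | tri< Gc<v _ _ = inj₁ Gc<v
  ... | tri≈ _ Gc≡v _ = ⊥-elim (GR-avoids a≤b (row-option a b c c<b) (sym Gc≡v))
  ... | tri> _ _ v<Gc with option-inv a c v (GR-covers a≤c v<Gc)
  ...   | inj₁ (c′ , c′<c , v≡Gc′) = ⊥-elim (GR-avoids a≤b (row-option a b c′ (<-trans c′<c c<b)) v≡Gc′)
  ...   | inj₂ (k , 1≤k , k≤a , v≡G) = inj₂ (k , 1≤k , k≤a , sym v≡G)

  code : ∀ {c} → Reason c → ℕ
  code {c} (inj₁ _)      = GR a c
  code     (inj₂ (k , _)) = v + (a ∸ k)

  code< : ∀ {c} (r : Reason c) → code r < v + a
  code< (inj₁ Gc<v)              = <-≤-trans Gc<v (m≤m+n v a)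
  code< (inj₂ (k , 1≤k , k≤a , _)) = +-monoʳ-< v (∸-monoʳ-< {a} {k} {0} 1≤k k≤a)

  -- Distinct columns have distinct codes: equal small codes contradict
  -- GR-row-cancel in row a, equal diagonal codes give the same k and hence
  -- the same value v twice in row a − k.
  code-injective : ∀ {c c′} → a ≤ c → a ≤ c′ → (r : Reason c) (r′ : Reason c′) → code r ≡ code r′ → c ≡ c′
  code-injective a≤c a≤c′ (inj₁ _) (inj₁ _) eq = GR-row-cancel a≤c a≤c′ eq
  code-injective _ _ (inj₁ Gc<v) (inj₂ _) eq = ⊥-elim (<-irrefl eq (<-≤-trans Gc<v (m≤m+n v _)))
  code-injective _ _ (inj₂ _) (inj₁ Gc<v) eq = ⊥-elim (<-irrefl (sym eq) (<-≤-trans Gc<v (m≤m+n v _)))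
  code-injective a≤c a≤c′ (inj₂ (k , _ , k≤a , Gc≡v)) (inj₂ (k′ , _ , k′≤a , Gc′≡v)) eq
    with refl ← ∸-cancelˡ-≡ k≤a k′≤a (+-cancelˡ-≡ v _ _ eq) =
    ∸-cancelʳ-≡ (≤-trans k≤a a≤c) (≤-trans k≤a a≤c′)
      (GR-row-cancel (∸-monoˡ-≤ k a≤c) (∸-monoˡ-≤ k a≤c′) (trans Gc≡v (sym Gc′≡v)))

  -- For a ≥ 3 some value below v + a is never a code.  (v = a is
  -- impossible because (a,0) is an option of (a,b).)
  code-hole : 3 ≤ a → Σ ℕ λ e → e < v + a × (∀ {c} → a ≤ c → (r : Reason c) → code r ≢ e)
  code-hole 3≤a with <-cmp v a
  ... | tri≈ _ v≡a _ = ⊥-elim (GR-not-pile-size (≤-trans (s≤s z≤n) (≤-trans 3≤a a≤b)) a≤b v≡a)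
  ... | tri> _ _ a<v = a , <-≤-trans a<v (m≤m+n v a) , no-a
    where
    -- G(a,c) = a is impossible, and diagonal codes are at least v > a
    no-a : ∀ {c} → a ≤ c → (r : Reason c) → code r ≢ a
    no-a a≤c (inj₁ _) = GR-not-pile-size (≤-trans (s≤s z≤n) (≤-trans 3≤a a≤c)) a≤c
    no-a a≤c (inj₂ _) eq = <-irrefl (sym eq) (<-≤-trans a<v (m≤m+n v _))
  ... | tri< v<a _ _ with row-avoiding v 3≤a v<a
  ...   | j , j<a , v∉row = v + j , +-monoʳ-< v j<a , no-v+j
    where
    -- codes G(a,c) are below v, and v + (a−k) = v + j would put v in row j
    no-v+j : ∀ {c} → a ≤ c → (r : Reason c) → code r ≢ v + j
    no-v+j a≤c (inj₁ Gc<v) eq = <-irrefl eq (<-≤-trans Gc<v (m≤m+n v j))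
    no-v+j a≤c (inj₂ (k , _ , _ , G≡v)) eq with refl ← +-cancelˡ-≡ v _ _ eq =
      v∉row (∸-monoˡ-≤ k a≤c) G≡v

  columns-bound : 3 ≤ a → b ∸ a < v + a
  columns-bound 3≤a with code-hole 3≤a
  ... | e , e<v+a , no-e = injection-with-hole columnCode columnCode-inj
          (λ i → code< (columnReason i)) e<v+a (λ i → no-e (column≥ i) (columnReason i))
    where
    column : Fin (b ∸ a) → ℕ
    column i = a + toℕ i

    column≥ : ∀ i → a ≤ column i
    column≥ i = m≤m+n a (toℕ i)

    column< : ∀ i → column i < b
    column< i = subst (column i <_) (m+[n∸m]≡n a≤b) (+-monoʳ-< a (toℕ<n i))

    columnReason : ∀ i → Reason (column i)
    columnReason i = reason (column≥ i) (column< i)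

    columnCode : Fin (b ∸ a) → ℕ
    columnCode i = code (columnReason i)

    columnCode-inj : Injective _≡_ _≡_ columnCode
    columnCode-inj {i} {j} eq = toℕ-injective (+-cancelˡ-≡ a _ _
      (code-injective (column≥ i) (column≥ j) (columnReason i) (columnReason j) eq))

theorem2p13 : (a b : ℕ) → 4 ≤ a → a ≤ b → (b + 1) ∸ (2 * a) ≤ GR a b
theorem2p13 a b 4≤a a≤b =
  rearrange-bound a b (GR a b) a≤b (RowCount.columns-bound a b a≤b (≤-trans (n≤1+n 3) 4≤a))
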